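{- For every $\epsilon > 0$ there is a constant $C_\epsilon$ such that the following holds. Let $X \geq 2$ and let $\mu, \nu$ be nonnegative integers with $2^{\mu} \leq X^{1/20}$ and $2^{\mu+\nu} \leq X$. For each integer $m \sim 2^{\mu}$ let $I_m \subseteq (2^{\nu-1}, 2^{\nu}]$ be an interval. Then \[ \sum_{m \sim 2^{\mu}} \Big|\sum_{n \in I_m} f(mn)\Big| \leq C_\epsilon X^{19/20 + \epsilon}. \]
   Context: For a positive integer $n$ with binary expansion $n = \sum_{i\ge 0} n_i 2^i$, $n_i\in\{0,1\}$, let $s(n) := \sum_i n_i$ be its binary digit sum, and $f(n) := (-1)^{s(n)}$. The notation $\sum_{m \sim 2^{\mu}}$ means $m$ ranges over integers in $[2^{\mu-1}, 2^{\mu})$.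
   Formalization: The parameters ε and X range over the rationals, and the constant $C_\epsilon$ is taken in the rationals as well. -}

module Defs where

open import Data.Nat using (ℕ; zero; suc; _+_; _*_; _∸_; _≤ᵇ_)
open import Data.Nat.DivMod using (_/_; _%_)
open import Data.Integer as ℤ using (ℤ; +_; -_; ∣_∣)
open import Data.List using (List; map; upTo; filterᵇ)
open import Data.Nat.ListAction using (sum)
import Data.Rational as ℚ
open import Data.Rational using (ℚ)

-- binary digit sum s(n), computed with fuel n (n halvings suffice)
digitSumAux : ℕ → ℕ → ℕ
digitSumAux zero    n = 0
digitSumAux (suc k) n = n % 2 + digitSumAux k (n / 2)

s : ℕ → ℕ
s n = digitSumAux n n

negOnePow : ℕ → ℤ
negOnePow zero    = + 1
negOnePow (suc k) = - negOnePow k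

f : ℕ → ℤ
f n = negOnePow (s n)

sumℤ : List ℤ → ℤ
sumℤ = Data.List.foldr ℤ._+_ (+ 0)

-- the integers n with a ≤ n ≤ b (empty if b < a)
range : ℕ → ℕ → List ℕ
range a b = map (λ i → a + i) (upTo (suc b ∸ a))

-- the integers m ~ 2^μ, i.e. m ∈ [2^{μ-1}, 2^μ) : those m < 2^μ with 2^μ ≤ 2m
dyadic : ℕ → List ℕ
dyadic μ = filterᵇ (λ m → (2 Data.Nat.^ μ) ≤ᵇ (2 * m)) (upTo (2 Data.Nat.^ μ))

_^ℚ_ : ℚ → ℕ → ℚ
x ^ℚ zero  = ℚ.1ℚ
x ^ℚ suc k = x ℚ.* (x ^ℚ k)

ℕtoℚ : ℕ → ℚ
ℕtoℚ n = + n ℚ./ 1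

typeISum : ℕ → (ℕ → ℕ) → (ℕ → ℕ) → ℕ
typeISum μ a b = sum (map (λ m → ∣ sumℤ (map (λ n → f (m * n)) (range (a m) (b m))) ∣) (dyadic μ))

module Submission where

-- For fixed m the inner sum telescopes: it equals Q(m(B+1))(0) - Q(mA)(0), where
-- Q(N)(c) = Σ_{k < N, k + c ≡ 0 (mod m)} f(k) sums f along a residue class.  Because
-- f(2^r + t) = -f(t) for t < 2^r, the block sums G_r = Q(2^r) obey
-- G_{r+1}(c) = G_r(c) - G_r(c + 2^r), and their energy E_r = Σ_{c mod m} G_r(c)² satisfies
-- E_0 = 1, E_{r+1} ≤ 4 E_r and, by a sum-of-squares identity up to a coboundary, E_{r+2} ≤ 12 E_r.
-- Hence G_r(c)² ≤ E_r, and splitting N ≤ 2^L at a power of two gives Q(N)(c)² ≪ 12^(L/2) ≤ 2^(1.8 L).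
-- As m(B+1) ≤ 2^(μ+ν+1), every inner sum is ≪ 2^(0.9(μ+ν)); Cauchy–Schwarz over the ≤ 2^μ values of
-- m gives T^20 ≤ 16^20 · 2^(20μ) · (2^(μ+ν))^18 ≤ 16^20 · X^19.  The ε = p/q of the theorem
-- is then absorbed by X^(20p) ≥ 1, with C = 16.

open import Data.Nat using (ℕ)

module BinaryDigits where

  open import Defs using (digitSumAux; s; f; negOnePow)
  open import Data.Nat using (zero; suc; _+_; _*_; _^_; _≤_; _<_; z≤n; s≤s; _/_; _%_)
  open import Data.Nat.Properties
  open import Data.Nat.DivMod
  open import Data.Nat.Divisibility using (divides)
  import Data.Integer as ℤ
  open import Relation.Binary.PropositionalEquality

  -- Halving loses at least one: needed so that the recursion of digitSumAux keeps enough fuel.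
  half≤pred : ∀ {n j} → n ≤ suc j → n / 2 ≤ j
  half≤pred {zero}  _       = z≤n
  half≤pred {suc n} n≤1+j = ≤-pred (≤-trans (m/n<m (suc n) 2 (s≤s (s≤s z≤n))) n≤1+j)

  digitSumAux-fuel : ∀ {k k′ n} → n ≤ k → n ≤ k′ → digitSumAux k n ≡ digitSumAux k′ n
  digitSumAux-fuel {zero}  {zero}   z≤n z≤n = refl
  digitSumAux-fuel {zero}  {suc k′} z≤n z≤n = digitSumAux-fuel {zero} {k′} z≤n z≤n
  digitSumAux-fuel {suc k} {zero}   z≤n z≤n = digitSumAux-fuel {k} {zero} z≤n z≤n
  digitSumAux-fuel {suc k} {suc k′} {n} n≤1+k n≤1+k′ =
    cong (n % 2 +_) (digitSumAux-fuel (half≤pred n≤1+k) (half≤pred n≤1+k′))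

  s-rec : ∀ n → s n ≡ n % 2 + s (n / 2)
  s-rec zero    = refl
  s-rec (suc n) = cong (suc n % 2 +_) (digitSumAux-fuel {n} {suc n / 2} (half≤pred ≤-refl) ≤-refl)

  s-leading-digit : ∀ r t → t < 2 ^ r → s (2 ^ r + t) ≡ suc (s t)
  s-leading-digit zero    zero    _            = refl
  s-leading-digit zero    (suc t) (s≤s ())
  s-leading-digit (suc r) t       t<2^[1+r] = begin
    s (2 ^ suc r + t)                           ≡⟨ cong s (+-comm (2 ^ suc r) t) ⟩
    s (t + 2 ^ suc r)                           ≡⟨ s-rec (t + 2 ^ suc r) ⟩
    (t + 2 ^ suc r) % 2 + s ((t + 2 ^ suc r) / 2) ≡⟨ cong₂ (λ d h → d + s h) low-digit high-digits ⟩
    t % 2 + s (2 ^ r + t / 2)                    ≡⟨ cong (t % 2 +_) (s-leading-digit r (t / 2) half<) ⟩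
    t % 2 + suc (s (t / 2))                      ≡⟨ +-suc (t % 2) (s (t / 2)) ⟩
    suc (t % 2 + s (t / 2))                      ≡⟨ cong suc (s-rec t) ⟨
    suc (s t)                                    ∎
    where
    open ≡-Reasoning
    shifted : t + 2 ^ suc r ≡ t + 2 ^ r * 2
    shifted = cong (t +_) (*-comm 2 (2 ^ r))
    low-digit : (t + 2 ^ suc r) % 2 ≡ t % 2
    low-digit = trans (cong (_% 2) shifted) ([m+kn]%n≡m%n t (2 ^ r) 2)
    high-digits : (t + 2 ^ suc r) / 2 ≡ 2 ^ r + t / 2
    high-digits = begin
      (t + 2 ^ suc r) / 2   ≡⟨ cong (_/ 2) shifted ⟩
      (t + 2 ^ r * 2) / 2   ≡⟨ +-distrib-/-∣ʳ t (divides (2 ^ r) refl) ⟩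
      t / 2 + 2 ^ r * 2 / 2 ≡⟨ cong (t / 2 +_) (m*n/n≡m (2 ^ r) 2) ⟩
      t / 2 + 2 ^ r         ≡⟨ +-comm (t / 2) (2 ^ r) ⟩
      2 ^ r + t / 2         ∎
    half< : t / 2 < 2 ^ r
    half< = m<n*o⇒m/o<n (subst (t <_) (*-comm 2 (2 ^ r)) t<2^[1+r])

  f-leading-digit : ∀ r t → t < 2 ^ r → f (2 ^ r + t) ≡ ℤ.- f t
  f-leading-digit r t t<2^r = cong negOnePow (s-leading-digit r t t<2^r)

module Squares where

  open import Data.Nat as ℕ using (z≤n)
  open import Data.Integer using (+_; -[1+_]; _+_; _-_; _*_; _≤_; +≤+)
  import Data.Integer.Properties as ℤP
  open import Data.Integer.Tactic.RingSolver using (solve-∀)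
  open import Relation.Binary.PropositionalEquality

  ≤-by-gap : ∀ {x y} d → + 0 ≤ d → y ≡ x + d → x ≤ y
  ≤-by-gap {x} d 0≤d refl = subst (_≤ x + d) (ℤP.+-identityʳ x) (ℤP.+-monoʳ-≤ x 0≤d)

  square-nonneg : ∀ x → + 0 ≤ x * x
  square-nonneg (+ n)      = subst (+ 0 ≤_) (ℤP.pos-* n n) (+≤+ z≤n)
  square-nonneg -[1+ n ]   = +≤+ z≤n

  -- (x - y)² ≤ 2x² + 2y², the gap being (x + y)².
  square-of-difference : ∀ x y → (x - y) * (x - y) ≤ + 2 * (x * x) + + 2 * (y * y)
  square-of-difference x y = ≤-by-gap ((x + y) * (x + y)) (square-nonneg (x + y)) (identity x y)
    where
    identity : ∀ x y → + 2 * (x * x) + + 2 * (y * y) ≡ (x - y) * (x - y) + (x + y) * (x + y)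
    identity = solve-∀

  square-of-difference-bound : ∀ {x y u v} → x * x ≤ + u → y * y ≤ + v →
                               (x - y) * (x - y) ≤ + (2 ℕ.* u ℕ.+ 2 ℕ.* v)
  square-of-difference-bound {x} {y} {u} {v} x²≤u y²≤v = begin
    (x - y) * (x - y)                  ≤⟨ square-of-difference x y ⟩
    + 2 * (x * x) + + 2 * (y * y)      ≤⟨ ℤP.+-mono-≤ (ℤP.*-monoˡ-≤-nonNeg (+ 2) x²≤u) (ℤP.*-monoˡ-≤-nonNeg (+ 2) y²≤v) ⟩
    + 2 * + u + + 2 * + v              ≡⟨ cong₂ _+_ (ℤP.pos-* 2 u) (ℤP.pos-* 2 v) ⟨
    + (2 ℕ.* u) + + (2 ℕ.* v)          ≡⟨ ℤP.pos-+ (2 ℕ.* u) (2 ℕ.* v) ⟨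
    + (2 ℕ.* u ℕ.+ 2 ℕ.* v)            ∎
    where open ℤP.≤-Reasoning

module FiniteSums where

  open import Data.Nat as ℕ using (ℕ; zero; suc; _<_; NonZero; _%_; _/_)
  open import Data.Nat.DivMod using (m≡m%n+[m/n]*n)
  import Data.Nat.Properties as ℕP
  open import Data.Integer using (ℤ; +_; -_; _+_; _-_; _*_; _≤_)
  import Data.Integer.Properties as ℤP
  open import Data.Integer.Tactic.RingSolver using (solve-∀)
  open import Data.Sum using (inj₁; inj₂)
  open import Relation.Binary.PropositionalEquality
  open import Algebra.Bundles using (AbelianGroup)
  open import Algebra.Properties.Group (AbelianGroup.group ℤP.+-0-abelianGroup) using (∙-cancelˡ)
  open Squares using (≤-by-gap)

  Σ< : ℕ → (ℕ → ℤ) → ℤ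
  Σ< zero    h = + 0
  Σ< (suc n) h = Σ< n h + h n

  Σ-cong : ∀ n {h k : ℕ → ℤ} → (∀ c → c < n → h c ≡ k c) → Σ< n h ≡ Σ< n k
  Σ-cong zero    eq = refl
  Σ-cong (suc n) eq = cong₂ _+_ (Σ-cong n (λ c c<n → eq c (ℕP.m<n⇒m<1+n c<n))) (eq n ℕP.≤-refl)

  Σ-zeros : ∀ n → Σ< n (λ _ → + 0) ≡ + 0
  Σ-zeros zero    = refl
  Σ-zeros (suc n) = cong (_+ + 0) (Σ-zeros n)

  Σ-zero : ∀ n (h : ℕ → ℤ) → (∀ c → c < n → h c ≡ + 0) → Σ< n h ≡ + 0
  Σ-zero n h vanish = trans (Σ-cong n vanish) (Σ-zeros n)

  Σ-+ : ∀ n (h k : ℕ → ℤ) → Σ< n (λ c → h c + k c) ≡ Σ< n h + Σ< n k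
  Σ-+ zero    h k = refl
  Σ-+ (suc n) h k = trans (cong (_+ (h n + k n)) (Σ-+ n h k)) (interchange (Σ< n h) (Σ< n k) (h n) (k n))
    where
    interchange : ∀ a b x y → (a + b) + (x + y) ≡ (a + x) + (b + y)
    interchange = solve-∀

  Σ-neg : ∀ n (h : ℕ → ℤ) → Σ< n (λ c → - h c) ≡ - Σ< n h
  Σ-neg zero    h = refl
  Σ-neg (suc n) h = trans (cong (_+ - h n) (Σ-neg n h)) (sym (ℤP.neg-distrib-+ (Σ< n h) (h n)))

  Σ-scale : ∀ n z (h : ℕ → ℤ) → Σ< n (λ c → z * h c) ≡ z * Σ< n h
  Σ-scale zero    z h = sym (ℤP.*-zeroʳ z)
  Σ-scale (suc n) z h = trans (cong (_+ z * h n) (Σ-scale n z h)) (sym (ℤP.*-distribˡ-+ z (Σ< n h) (h n)))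

  Σ-mono : ∀ n {h k : ℕ → ℤ} → (∀ c → h c ≤ k c) → Σ< n h ≤ Σ< n k
  Σ-mono zero    h≤k = ℤP.≤-refl
  Σ-mono (suc n) h≤k = ℤP.+-mono-≤ (Σ-mono n h≤k) (h≤k n)

  Σ-nonneg : ∀ n (h : ℕ → ℤ) → (∀ c → + 0 ≤ h c) → + 0 ≤ Σ< n h
  Σ-nonneg n h 0≤h = subst (_≤ Σ< n h) (Σ-zeros n) (Σ-mono n 0≤h)

  term≤Σ : ∀ n (h : ℕ → ℤ) → (∀ c → + 0 ≤ h c) → ∀ {c} → c < n → h c ≤ Σ< n h
  term≤Σ (suc n) h 0≤h c<1+n with ℕP.m<1+n⇒m<n∨m≡n c<1+n
  ... | inj₁ c<n  = ℤP.≤-trans (term≤Σ n h 0≤h c<n) (≤-by-gap (h n) (0≤h n) refl)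
  ... | inj₂ refl = ≤-by-gap (Σ< n h) (Σ-nonneg n h 0≤h) (ℤP.+-comm (Σ< n h) (h n))

  Σ-front : ∀ n (h : ℕ → ℤ) → Σ< (suc n) h ≡ h 0 + Σ< n (λ c → h (suc c))
  Σ-front zero    h = ℤP.+-comm (+ 0) (h 0)
  Σ-front (suc n) h = trans (cong (_+ h (suc n)) (Σ-front n h)) (ℤP.+-assoc (h 0) _ (h (suc n)))

  Σ-single : ∀ n (h : ℕ → ℤ) → (∀ c → c < n → h (suc c) ≡ + 0) → Σ< (suc n) h ≡ h 0
  Σ-single n h vanish = begin
    Σ< (suc n) h                    ≡⟨ Σ-front n h ⟩
    h 0 + Σ< n (λ c → h (suc c))    ≡⟨ cong (λ z → h 0 + z) (Σ-zero n (λ c → h (suc c)) vanish) ⟩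
    h 0 + + 0                       ≡⟨ ℤP.+-identityʳ (h 0) ⟩
    h 0                             ∎
    where open ≡-Reasoning

  Σ-split : ∀ a t (h : ℕ → ℤ) → Σ< (a ℕ.+ t) h ≡ Σ< a h + Σ< t (λ k → h (a ℕ.+ k))
  Σ-split a zero    h = trans (cong (λ n → Σ< n h) (ℕP.+-identityʳ a)) (sym (ℤP.+-identityʳ (Σ< a h)))
  Σ-split a (suc t) h = begin
    Σ< (a ℕ.+ suc t) h                                      ≡⟨ cong (λ n → Σ< n h) (ℕP.+-suc a t) ⟩
    Σ< (a ℕ.+ t) h + h (a ℕ.+ t)                            ≡⟨ cong (_+ h (a ℕ.+ t)) (Σ-split a t h) ⟩
    Σ< a h + Σ< t (λ k → h (a ℕ.+ k)) + h (a ℕ.+ t)         ≡⟨ ℤP.+-assoc (Σ< a h) _ (h (a ℕ.+ t)) ⟩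
    Σ< a h + Σ< (suc t) (λ k → h (a ℕ.+ k))                 ∎
    where open ≡-Reasoning

  module Periodicity (m : ℕ) where

    Periodic : (ℕ → ℤ) → Set
    Periodic h = ∀ c → h (c ℕ.+ m) ≡ h c

    shift-periodic : ∀ {h} a → Periodic h → Periodic (λ c → h (c ℕ.+ a))
    shift-periodic {h} a per c = trans (cong h reorder) (per (c ℕ.+ a))
      where
      reorder : c ℕ.+ m ℕ.+ a ≡ c ℕ.+ a ℕ.+ m
      reorder = trans (ℕP.+-assoc c m a) (trans (cong (c ℕ.+_) (ℕP.+-comm m a)) (sym (ℕP.+-assoc c a m)))

    periodic-map : ∀ (F : ℤ → ℤ) {u} → Periodic u → Periodic (λ c → F (u c))
    periodic-map F pu c = cong F (pu c)

    periodic-map₃ : ∀ (F : ℤ → ℤ → ℤ → ℤ) {u v w} → Periodic u → Periodic v → Periodic w →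
                    Periodic (λ c → F (u c) (v c) (w c))
    periodic-map₃ F pu pv pw c rewrite pu c | pv c | pw c = refl

    periodic-multiple : ∀ {h} → Periodic h → ∀ c k → h (c ℕ.+ k ℕ.* m) ≡ h c
    periodic-multiple {h} per c zero    = cong h (ℕP.+-identityʳ c)
    periodic-multiple {h} per c (suc k) =
      trans (cong h reorder) (trans (per (c ℕ.+ k ℕ.* m)) (periodic-multiple per c k))
      where
      reorder : c ℕ.+ (m ℕ.+ k ℕ.* m) ≡ c ℕ.+ k ℕ.* m ℕ.+ m
      reorder = trans (cong (c ℕ.+_) (ℕP.+-comm m (k ℕ.* m))) (sym (ℕP.+-assoc c (k ℕ.* m) m))

    periodic-mod : ∀ {h} .{{_ : NonZero m}} → Periodic h → ∀ c → h c ≡ h (c % m)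
    periodic-mod {h} per c = trans (cong h (m≡m%n+[m/n]*n c m)) (periodic-multiple per (c % m) (c / m))

    Σ-shift-by-one : ∀ {h} → Periodic h → Σ< m (λ c → h (suc c)) ≡ Σ< m h
    Σ-shift-by-one {h} per = ∙-cancelˡ (h 0) _ _ (begin
      h 0 + Σ< m (λ c → h (suc c))   ≡⟨ Σ-front m h ⟨
      Σ< m h + h m                   ≡⟨ cong (λ z → Σ< m h + z) (per 0) ⟩
      Σ< m h + h 0                   ≡⟨ ℤP.+-comm (Σ< m h) (h 0) ⟩
      h 0 + Σ< m h                   ∎)
      where open ≡-Reasoning

    Σ-shift-invariant : ∀ {h} a → Periodic h → Σ< m (λ c → h (c ℕ.+ a)) ≡ Σ< m h
    Σ-shift-invariant {h} zero    per = Σ-cong m (λ c _ → cong h (ℕP.+-identityʳ c))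
    Σ-shift-invariant {h} (suc a) per = begin
      Σ< m (λ c → h (c ℕ.+ suc a))   ≡⟨ Σ-cong m (λ c _ → cong h (ℕP.+-suc c a)) ⟩
      Σ< m (λ c → h (suc c ℕ.+ a))   ≡⟨ Σ-shift-by-one (shift-periodic a per) ⟩
      Σ< m (λ c → h (c ℕ.+ a))       ≡⟨ Σ-shift-invariant a per ⟩
      Σ< m h                         ∎
      where open ≡-Reasoning

    -- A coboundary φ(c + a) - φ(c) of a periodic φ sums to zero over a period, so a pointwise
    -- inequality that holds up to such a coboundary holds for the sums over a period.
    Σ-≤-modulo-coboundary : ∀ a {P R φ : ℕ → ℤ} → Periodic φ →
                            (∀ c → P c ≤ R c + (φ (c ℕ.+ a) - φ c)) → Σ< m P ≤ Σ< m R
    Σ-≤-modulo-coboundary a {P} {R} {φ} per P≤R+δφ = begin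
      Σ< m P                                            ≤⟨ Σ-mono m P≤R+δφ ⟩
      Σ< m (λ c → R c + (φ (c ℕ.+ a) - φ c))            ≡⟨ Σ-+ m R _ ⟩
      Σ< m R + Σ< m (λ c → φ (c ℕ.+ a) - φ c)           ≡⟨ cong (λ z → Σ< m R + z) coboundary-vanishes ⟩
      Σ< m R + + 0                                      ≡⟨ ℤP.+-identityʳ (Σ< m R) ⟩
      Σ< m R                                            ∎
      where
      open ℤP.≤-Reasoning
      coboundary-vanishes : Σ< m (λ c → φ (c ℕ.+ a) - φ c) ≡ + 0
      coboundary-vanishes = begin-equality
        Σ< m (λ c → φ (c ℕ.+ a) - φ c)                  ≡⟨ Σ-+ m (λ c → φ (c ℕ.+ a)) (λ c → - φ c) ⟩
        Σ< m (λ c → φ (c ℕ.+ a)) + Σ< m (λ c → - φ c)   ≡⟨ cong₂ _+_ (Σ-shift-invariant a per) (Σ-neg m φ) ⟩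
        Σ< m φ - Σ< m φ                                 ≡⟨ ℤP.+-inverseʳ (Σ< m φ) ⟩
        + 0                                             ∎

module GrowthBounds where

  open import Data.Nat using (ℕ; zero; suc; _+_; _*_; _^_; _≤_)
  open import Data.Nat.Properties
  open import Data.Nat.Tactic.RingSolver using (solve-∀)
  open import Relation.Binary.PropositionalEquality

  ^-distribʳ-* : ∀ a b n → (a * b) ^ n ≡ a ^ n * b ^ n
  ^-distribʳ-* a b zero    = refl
  ^-distribʳ-* a b (suc n) = trans (cong (a * b *_) (^-distribʳ-* a b n)) (interchange a b (a ^ n) (b ^ n))
    where
    interchange : ∀ a b x y → (a * b) * (x * y) ≡ (a * x) * (b * y)
    interchange = solve-∀

  -- Bound for the energy after r doubling steps: a factor 4 for one step, 12 for two.
  energyBound : ℕ → ℕ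
  energyBound zero          = 1
  energyBound (suc zero)    = 4
  energyBound (suc (suc r)) = 12 * energyBound r

  -- Bound for the square of a partial sum of length at most 2^L; it absorbs the energy bounds.
  partialBound : ℕ → ℕ
  partialBound zero          = 4
  partialBound (suc zero)    = 16
  partialBound (suc (suc L)) = 12 * partialBound L

  -- The recursion that a partial sum of length ≤ 2^(L+1), split at 2^L, needs.
  partialBound-step : ∀ L → 2 * energyBound L + 2 * partialBound L ≤ partialBound (suc L)
  partialBound-step zero          = ≤ᵇ⇒≤ 10 16 _
  partialBound-step (suc zero)    = ≤ᵇ⇒≤ 40 48 _
  partialBound-step (suc (suc L)) =
    subst (_≤ 12 * partialBound (suc L)) (distribute (energyBound L) (partialBound L))
          (*-monoʳ-≤ 12 (partialBound-step L))
    where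
    distribute : ∀ e u → 12 * (2 * e + 2 * u) ≡ 2 * (12 * e) + 2 * (12 * u)
    distribute = solve-∀

  partialBound-mono : ∀ L → partialBound L ≤ partialBound (suc L)
  partialBound-mono L = ≤-trans (≤-trans (m≤n*m (partialBound L) 2) (m≤n+m _ (2 * energyBound L)))
                                (partialBound-step L)

  -- Geometric growth of partialBound: if partialBound L ^ 10 ≤ b·a^L holds for L = 0, 1 and
  -- a² ≥ 12^10, it holds for all L.  With a = 2^18 this says partialBound L ≤ 16·2^(0.9 L).
  partialBound-pow : ∀ a b → partialBound 0 ^ 10 ≤ b * a ^ 0 → partialBound 1 ^ 10 ≤ b * a ^ 1 →
                     12 ^ 10 ≤ a * a → ∀ L → partialBound L ^ 10 ≤ b * a ^ L
  partialBound-pow a b base₀ base₁ growth zero          = base₀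
  partialBound-pow a b base₀ base₁ growth (suc zero)    = base₁
  partialBound-pow a b base₀ base₁ growth (suc (suc L)) = begin
    (12 * partialBound L) ^ 10         ≡⟨ ^-distribʳ-* 12 (partialBound L) 10 ⟩
    12 ^ 10 * partialBound L ^ 10      ≤⟨ *-mono-≤ growth (partialBound-pow a b base₀ base₁ growth L) ⟩
    (a * a) * (b * a ^ L)              ≡⟨ rearrange a b (a ^ L) ⟩
    b * (a * (a * a ^ L))              ∎
    where
    open ≤-Reasoning
    rearrange : ∀ a b c → (a * a) * (b * c) ≡ b * (a * (a * c))
    rearrange = solve-∀

module ResidueClassSums (m′ : ℕ) where

  open import Defs using (f)
  open import Data.Nat as ℕ using (ℕ; zero; suc; _^_; _<_; _%_; _≡ᵇ_)
  import Data.Nat.Properties as ℕP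
  open import Data.Nat.DivMod using ([m+n]%n≡m%n; [m+kn]%n≡m%n; m<n⇒m%n≡m; m%n<n)
  open import Data.Integer using (ℤ; +_; -_; _+_; _-_; _*_; _≤_; +≤+)
  import Data.Integer.Properties as ℤP
  open import Data.Integer.Tactic.RingSolver using (solve-∀)
  open import Data.Bool using (Bool; true; false; if_then_else_)
  open import Relation.Binary.PropositionalEquality
  open import Relation.Nullary using (yes; no)
  open BinaryDigits using (f-leading-digit)
  open GrowthBounds using (energyBound; partialBound; partialBound-step; partialBound-mono)
  open FiniteSums
  open Squares

  m : ℕ
  m = suc m′

  open Periodicity m

  hit : ℕ → ℕ → ℤ
  hit k c = if (k ℕ.+ c) % m ≡ᵇ 0 then f k else + 0

  Q : ℕ → ℕ → ℤ
  Q N c = Σ< N (λ k → hit k c)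

  hit-periodic : ∀ k → Periodic (hit k)
  hit-periodic k c = cong (λ r → if r ≡ᵇ 0 then f k else + 0)
                          (trans (cong (_% m) (sym (ℕP.+-assoc k c m))) ([m+n]%n≡m%n (k ℕ.+ c) m))

  Q-periodic : ∀ N → Periodic (Q N)
  Q-periodic N c = Σ-cong N (λ k _ → hit-periodic k c)

  hit-leading-digit : ∀ r t c → t < 2 ^ r → hit (2 ^ r ℕ.+ t) c ≡ - hit t (c ℕ.+ 2 ^ r)
  hit-leading-digit r t c t<2^r =
    trans (cong (λ n → if n % m ≡ᵇ 0 then f (2 ^ r ℕ.+ t) else + 0) same-residue)
          (flip ((t ℕ.+ (c ℕ.+ 2 ^ r)) % m ≡ᵇ 0) (f-leading-digit r t t<2^r))
    where
    same-residue : 2 ^ r ℕ.+ t ℕ.+ c ≡ t ℕ.+ (c ℕ.+ 2 ^ r)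
    same-residue = trans (cong (ℕ._+ c) (ℕP.+-comm (2 ^ r) t))
                         (trans (ℕP.+-assoc t (2 ^ r) c) (cong (t ℕ.+_) (ℕP.+-comm (2 ^ r) c)))
    flip : ∀ (b : Bool) {u v : ℤ} → u ≡ - v → (if b then u else + 0) ≡ - (if b then v else + 0)
    flip true  u≡-v = u≡-v
    flip false _    = refl

  Q-split : ∀ r t c → t ℕ.≤ 2 ^ r → Q (2 ^ r ℕ.+ t) c ≡ Q (2 ^ r) c - Q t (c ℕ.+ 2 ^ r)
  Q-split r t c t≤2^r = begin
    Q (2 ^ r ℕ.+ t) c                                     ≡⟨ Σ-split (2 ^ r) t (λ k → hit k c) ⟩
    Q (2 ^ r) c + Σ< t (λ k → hit (2 ^ r ℕ.+ k) c)        ≡⟨ cong (λ z → Q (2 ^ r) c + z) flipped ⟩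
    Q (2 ^ r) c - Q t (c ℕ.+ 2 ^ r)                       ∎
    where
    open ≡-Reasoning
    flipped : Σ< t (λ k → hit (2 ^ r ℕ.+ k) c) ≡ - Q t (c ℕ.+ 2 ^ r)
    flipped = trans (Σ-cong t (λ k k<t → hit-leading-digit r k c (ℕP.<-≤-trans k<t t≤2^r)))
                    (Σ-neg t (λ k → hit k (c ℕ.+ 2 ^ r)))

  G : ℕ → ℕ → ℤ
  G r = Q (2 ^ r)

  G-periodic : ∀ r → Periodic (G r)
  G-periodic r = Q-periodic (2 ^ r)

  G-rec : ∀ r c → G (suc r) c ≡ G r c - G r (c ℕ.+ 2 ^ r)
  G-rec r c = trans (cong (λ N → Q N c) doubling) (Q-split r (2 ^ r) c ℕP.≤-refl)
    where
    doubling : 2 ^ suc r ≡ 2 ^ r ℕ.+ 2 ^ r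
    doubling = cong (2 ^ r ℕ.+_) (ℕP.+-identityʳ (2 ^ r))

  energy : ℕ → ℤ
  energy r = Σ< m (λ c → G r c * G r c)

  -- At level 0 only the residue class of 0 is hit, by f(0) = 1.
  energy-zero : energy 0 ≡ + 1
  energy-zero = Σ-single m′ (λ c → G 0 c * G 0 c) missed
    where
    missed : ∀ c → c < m′ → G 0 (suc c) * G 0 (suc c) ≡ + 0
    missed c c<m′ rewrite m<n⇒m%n≡m {m} {suc c} (ℕ.s≤s c<m′) = refl

  -- One doubling step multiplies the energy by at most 4:
  -- (x - y)² = 4x² + (2y² - 2x²) - (x + y)², and 2y² - 2x² is a coboundary.
  energy-one-step : ∀ r → energy (suc r) ≤ + 4 * energy r
  energy-one-step r = subst (energy (suc r) ≤_) (Σ-scale m (+ 4) (λ c → G r c * G r c))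
    (Σ-≤-modulo-coboundary a (periodic-map φ (G-periodic r)) pointwise)
    where
    a = 2 ^ r
    φ : ℤ → ℤ
    φ x = + 2 * (x * x)
    identity : ∀ x y → + 4 * (x * x) + (+ 2 * (y * y) - + 2 * (x * x)) ≡ (x - y) * (x - y) + (x + y) * (x + y)
    identity = solve-∀
    pointwise : ∀ c → G (suc r) c * G (suc r) c ≤ + 4 * (G r c * G r c) + (φ (G r (c ℕ.+ a)) - φ (G r c))
    pointwise c = subst (λ g → g * g ≤ + 4 * (x * x) + (φ y - φ x)) (sym (G-rec r c))
                    (≤-by-gap ((x + y) * (x + y)) (square-nonneg (x + y)) (identity x y))
      where
      x = G r c
      y = G r (c ℕ.+ a)

  -- Two doubling steps multiply the energy by at most 12 (instead of the trivial 16):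
  -- with x, y, z, w the values of G r at c, c + a, c + 2a, c + 3a,
  -- 12x² + (φ(y,z,w) - φ(x,y,z)) = ((x - y) - (z - w))² + (x + y)² + 2(x + z)² + (x - w)².
  energy-two-steps : ∀ r → energy (suc (suc r)) ≤ + 12 * energy r
  energy-two-steps r = subst (energy (suc (suc r)) ≤_) (Σ-scale m (+ 12) (λ c → G r c * G r c))
    (Σ-≤-modulo-coboundary a (periodic-map₃ φ g₀-periodic g₁-periodic g₂-periodic) pointwise)
    where
    a = 2 ^ r
    g₀ g₁ g₂ g₃ : ℕ → ℤ
    g₀ c = G r c
    g₁ c = G r (c ℕ.+ a)
    g₂ c = G r (c ℕ.+ a ℕ.+ a)
    g₃ c = G r (c ℕ.+ a ℕ.+ a ℕ.+ a)
    g₀-periodic : Periodic g₀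
    g₀-periodic = G-periodic r
    g₁-periodic : Periodic g₁
    g₁-periodic = shift-periodic a g₀-periodic
    g₂-periodic : Periodic g₂
    g₂-periodic = shift-periodic a g₁-periodic
    φ : ℤ → ℤ → ℤ → ℤ
    φ x y z = + 7 * (x * x) + + 5 * (y * y) + + 2 * (z * z) - + 2 * (x * z) - + 2 * (y * z)
    sum-of-squares : ℤ → ℤ → ℤ → ℤ → ℤ
    sum-of-squares x y z w = (x + y) * (x + y) + ((x + z) * (x + z) + (x + z) * (x + z)) + (x - w) * (x - w)
    sum-of-squares-nonneg : ∀ x y z w → + 0 ≤ sum-of-squares x y z w
    sum-of-squares-nonneg x y z w =
      ℤP.+-mono-≤ (ℤP.+-mono-≤ (square-nonneg (x + y))
                               (ℤP.+-mono-≤ (square-nonneg (x + z)) (square-nonneg (x + z))))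
                  (square-nonneg (x - w))
    identity : ∀ x y z w →
      + 12 * (x * x) + ((+ 7 * (y * y) + + 5 * (z * z) + + 2 * (w * w) - + 2 * (y * w) - + 2 * (z * w))
                       - (+ 7 * (x * x) + + 5 * (y * y) + + 2 * (z * z) - + 2 * (x * z) - + 2 * (y * z)))
      ≡ ((x - y) - (z - w)) * ((x - y) - (z - w))
        + ((x + y) * (x + y) + ((x + z) * (x + z) + (x + z) * (x + z)) + (x - w) * (x - w))
    identity = solve-∀
    two-steps : ∀ c → G (suc (suc r)) c ≡ (g₀ c - g₁ c) - (g₂ c - g₃ c)
    two-steps c = trans (G-rec (suc r) c) (cong₂ _-_ (G-rec r c) (trans (G-rec r (c ℕ.+ 2 ^ suc r))
                    (cong (λ n → G r n - G r (n ℕ.+ a)) twice)))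
      where
      twice : c ℕ.+ 2 ^ suc r ≡ c ℕ.+ a ℕ.+ a
      twice = trans (cong (λ n → c ℕ.+ (a ℕ.+ n)) (ℕP.+-identityʳ a)) (sym (ℕP.+-assoc c a a))
    pointwise : ∀ c → G (suc (suc r)) c * G (suc (suc r)) c
                      ≤ + 12 * (g₀ c * g₀ c) + (φ (g₁ c) (g₂ c) (g₃ c) - φ (g₀ c) (g₁ c) (g₂ c))
    pointwise c = subst (λ g → g * g ≤ + 12 * (x * x) + (φ y z w - φ x y z)) (sym (two-steps c))
                    (≤-by-gap (sum-of-squares x y z w) (sum-of-squares-nonneg x y z w) (identity x y z w))
      where
      x = g₀ c
      y = g₁ c
      z = g₂ c
      w = g₃ c

  energy-bound : ∀ r → energy r ≤ + energyBound r
  energy-bound zero          = ℤP.≤-reflexive energy-zero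
  energy-bound (suc zero)    = ℤP.≤-trans (energy-one-step 0) (ℤP.*-monoˡ-≤-nonNeg (+ 4) (energy-bound 0))
  energy-bound (suc (suc r)) =
    ℤP.≤-trans (energy-two-steps r)
      (subst (+ 12 * energy r ≤_) (sym (ℤP.pos-* 12 (energyBound r)))
             (ℤP.*-monoˡ-≤-nonNeg (+ 12) (energy-bound r)))

  -- Each single square G r c ² is at most the energy, since G r has period m.
  G-bound : ∀ r c → G r c * G r c ≤ + energyBound r
  G-bound r c = subst (_≤ + energyBound r) (sym (periodic-mod square-periodic c))
    (ℤP.≤-trans (term≤Σ m (λ c → G r c * G r c) (λ c → square-nonneg (G r c)) (m%n<n c m)) (energy-bound r))
    where
    square-periodic : Periodic (λ c → G r c * G r c)
    square-periodic = periodic-map (λ x → x * x) (G-periodic r)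

  -- Partial sums of length N ≤ 2^L satisfy Q N c ² ≤ partialBound L: for N > 2^(L-1), split N
  -- into the complete block 2^(L-1) and a shorter remainder (Q-split).
  Q-bound : ∀ L N c → N ℕ.≤ 2 ^ L → Q N c * Q N c ≤ + partialBound L
  Q-bound zero zero          c _              = +≤+ ℕ.z≤n
  Q-bound zero (suc zero)    c _              = ℤP.≤-trans (G-bound 0 c) (+≤+ (ℕ.s≤s ℕ.z≤n))
  Q-bound zero (suc (suc N)) c (ℕ.s≤s ())
  Q-bound (suc L) N c N≤2^[1+L] with N ℕ.≤? 2 ^ L
  ... | yes N≤2^L = ℤP.≤-trans (Q-bound L N c N≤2^L) (+≤+ (partialBound-mono L))
  ... | no  N≰2^L = subst (λ n → Q n c * Q n c ≤ + partialBound (suc L)) (ℕP.m+[n∸m]≡n (ℕP.<⇒≤ (ℕP.≰⇒> N≰2^L)))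
    (ℤP.≤-trans (subst (λ q → q * q ≤ _) (sym (Q-split L t c t≤a))
                       (square-of-difference-bound {G L c} {Q t (c ℕ.+ a)} (G-bound L c) (Q-bound L t (c ℕ.+ a) t≤a)))
                (+≤+ (partialBound-step L)))
    where
    a = 2 ^ L
    t = N ℕ.∸ a
    t≤a : t ℕ.≤ a
    t≤a = subst (t ℕ.≤_) (trans (ℕP.m+n∸m≡n a (a ℕ.+ 0)) (ℕP.+-identityʳ a)) (ℕP.∸-monoˡ-≤ a N≤2^[1+L])

  -- Along a block [mB, mB + m) only its first element mB lies in the class of 0.
  Q-block : ∀ B → Q (m ℕ.* B ℕ.+ m) 0 ≡ Q (m ℕ.* B) 0 + f (m ℕ.* B)
  Q-block B = trans (Σ-split (m ℕ.* B) m (λ k → hit k 0))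
                    (cong (λ z → Q (m ℕ.* B) 0 + z) (trans (Σ-single m′ _ off-class) on-class))
    where
    hit-in-block : ∀ k → hit (m ℕ.* B ℕ.+ k) 0 ≡ (if k % m ≡ᵇ 0 then f (m ℕ.* B ℕ.+ k) else + 0)
    hit-in-block k = cong (λ r → if r ≡ᵇ 0 then f (m ℕ.* B ℕ.+ k) else + 0)
      (trans (cong (_% m) (trans (ℕP.+-identityʳ _) (trans (ℕP.+-comm (m ℕ.* B) k) (cong (k ℕ.+_) (ℕP.*-comm m B)))))
             ([m+kn]%n≡m%n k B m))
    on-class : hit (m ℕ.* B ℕ.+ 0) 0 ≡ f (m ℕ.* B)
    on-class = trans (hit-in-block 0) (cong f (ℕP.+-identityʳ (m ℕ.* B)))
    off-class : ∀ c → c < m′ → hit (m ℕ.* B ℕ.+ suc c) 0 ≡ + 0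
    off-class c c<m′ rewrite hit-in-block (suc c) | m<n⇒m%n≡m {m} {suc c} (ℕ.s≤s c<m′) = refl

  dilated-sum : ∀ A len → Σ< len (λ i → f (m ℕ.* (A ℕ.+ i))) ≡ Q (m ℕ.* (A ℕ.+ len)) 0 - Q (m ℕ.* A) 0
  dilated-sum A zero = begin
    + 0                                   ≡⟨ ℤP.+-inverseʳ (Q (m ℕ.* A) 0) ⟨
    Q (m ℕ.* A) 0 - Q (m ℕ.* A) 0         ≡⟨ cong (λ n → Q (m ℕ.* n) 0 - Q (m ℕ.* A) 0) (ℕP.+-identityʳ A) ⟨
    Q (m ℕ.* (A ℕ.+ 0)) 0 - Q (m ℕ.* A) 0 ∎
    where open ≡-Reasoning
  dilated-sum A (suc len) = begin
    Σ< len (λ i → f (m ℕ.* (A ℕ.+ i))) + f (m ℕ.* n)  ≡⟨ cong (_+ f (m ℕ.* n)) (dilated-sum A len) ⟩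
    Q (m ℕ.* n) 0 - Q (m ℕ.* A) 0 + f (m ℕ.* n)       ≡⟨ reorder (Q (m ℕ.* n) 0) (Q (m ℕ.* A) 0) (f (m ℕ.* n)) ⟩
    Q (m ℕ.* n) 0 + f (m ℕ.* n) - Q (m ℕ.* A) 0       ≡⟨ cong (_- Q (m ℕ.* A) 0) (Q-block n) ⟨
    Q (m ℕ.* n ℕ.+ m) 0 - Q (m ℕ.* A) 0               ≡⟨ cong (λ k → Q k 0 - Q (m ℕ.* A) 0) next-block ⟩
    Q (m ℕ.* (A ℕ.+ suc len)) 0 - Q (m ℕ.* A) 0       ∎
    where
    open ≡-Reasoning
    n = A ℕ.+ len
    reorder : ∀ u v x → u - v + x ≡ u + x - v
    reorder = solve-∀
    next-block : m ℕ.* n ℕ.+ m ≡ m ℕ.* (A ℕ.+ suc len)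
    next-block = trans (ℕP.+-comm (m ℕ.* n) m)
                       (trans (sym (ℕP.*-suc m n)) (cong (m ℕ.*_) (sym (ℕP.+-suc A len))))

module DilatedSums where

  open import Defs using (f; sumℤ; range)
  open import Data.Nat as ℕ using (ℕ; zero; suc; _^_; _∸_)
  import Data.Nat.Properties as ℕP
  open import Data.Nat.Tactic.RingSolver using (solve-∀)
  open import Data.Integer using (ℤ; +_; _+_; _-_; _*_; _≤_; +≤+)
  open import Data.List using (map; upTo; applyUpTo)
  import Data.List.Properties as ListP
  open import Function using (_∘_)
  open import Relation.Binary.PropositionalEquality
  open import Relation.Nullary using (yes; no)
  open FiniteSums using (Σ<; Σ-front)
  open Squares using (square-of-difference-bound)
  open GrowthBounds using (partialBound)

  dilatedSum : ℕ → ℕ → ℕ → ℤ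
  dilatedSum m A B = sumℤ (map (λ n → f (m ℕ.* n)) (range A B))

  sumℤ-applyUpTo : ∀ n (h : ℕ → ℤ) → sumℤ (applyUpTo h n) ≡ Σ< n h
  sumℤ-applyUpTo zero    h = refl
  sumℤ-applyUpTo (suc n) h = trans (cong (λ z → h 0 + z) (sumℤ-applyUpTo n (h ∘ suc))) (sym (Σ-front n h))

  dilatedSum-as-Σ : ∀ m A B → dilatedSum m A B ≡ Σ< (suc B ∸ A) (λ i → f (m ℕ.* (A ℕ.+ i)))
  dilatedSum-as-Σ m A B =
    trans (cong sumℤ (trans (sym (ListP.map-∘ (upTo len))) (ListP.map-upTo _ len)))
          (sumℤ-applyUpTo len (λ i → f (m ℕ.* (A ℕ.+ i))))
    where
    len = suc B ∸ A

  -- For 0 < m ≤ 2^μ and B ≤ 2^ν the inner sum is a difference of two partial sums of length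
  -- at most 2^(μ+ν+1) along one residue class modulo m.
  dilatedSum-bound : ∀ μ ν m A B → 0 ℕ.< m → m ℕ.≤ 2 ^ μ → B ℕ.≤ 2 ^ ν →
                     dilatedSum m A B * dilatedSum m A B ≤ + (4 ℕ.* partialBound (suc (μ ℕ.+ ν)))
  dilatedSum-bound μ ν (suc m′) A B _ m≤2^μ B≤2^ν with A ℕ.≤? B
  ... | no  A≰B = subst (λ z → z * z ≤ _) (sym (trans (dilatedSum-as-Σ m A B) empty)) (+≤+ ℕ.z≤n)
    where
    m = suc m′
    empty : Σ< (suc B ∸ A) (λ i → f (m ℕ.* (A ℕ.+ i))) ≡ + 0
    empty = cong (λ len → Σ< len (λ i → f (m ℕ.* (A ℕ.+ i)))) (ℕP.m≤n⇒m∸n≡0 (ℕP.≰⇒> A≰B))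
  ... | yes A≤B = subst (λ z → z * z ≤ + (4 ℕ.* u)) (sym as-difference)
    (subst (λ k → difference * difference ≤ + k) (two-plus-two u)
      (square-of-difference-bound {Q (m ℕ.* suc B) 0} {Q (m ℕ.* A) 0}
        (Q-bound L (m ℕ.* suc B) 0 (index-bound (suc B) ℕP.≤-refl))
        (Q-bound L (m ℕ.* A) 0 (index-bound A (ℕP.m≤n⇒m≤1+n A≤B)))))
    where
    m = suc m′
    open ResidueClassSums m′ using (Q; Q-bound; dilated-sum)
    L = suc (μ ℕ.+ ν)
    u = partialBound L
    two-plus-two : ∀ u → 2 ℕ.* u ℕ.+ 2 ℕ.* u ≡ 4 ℕ.* u
    two-plus-two = solve-∀
    difference : ℤ
    difference = Q (m ℕ.* suc B) 0 - Q (m ℕ.* A) 0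
    as-difference : dilatedSum m A B ≡ difference
    as-difference = trans (dilatedSum-as-Σ m A B)
      (trans (dilated-sum A (suc B ∸ A)) (cong (λ n → Q (m ℕ.* n) 0 - Q (m ℕ.* A) 0) (ℕP.m+[n∸m]≡n (ℕP.m≤n⇒m≤1+n A≤B))))
    index-bound : ∀ k → k ℕ.≤ suc B → m ℕ.* k ℕ.≤ 2 ^ L
    index-bound k k≤1+B = begin
      m ℕ.* k                                 ≤⟨ ℕP.*-mono-≤ m≤2^μ (ℕP.≤-trans k≤1+B (ℕ.s≤s B≤2^ν)) ⟩
      2 ^ μ ℕ.* suc (2 ^ ν)                   ≡⟨ ℕP.*-suc (2 ^ μ) (2 ^ ν) ⟩
      2 ^ μ ℕ.+ 2 ^ μ ℕ.* 2 ^ ν               ≤⟨ ℕP.+-monoˡ-≤ _ (ℕP.m≤m*n (2 ^ μ) (2 ^ ν) {{ℕP.m^n≢0 2 ν}}) ⟩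
      2 ^ μ ℕ.* 2 ^ ν ℕ.+ 2 ^ μ ℕ.* 2 ^ ν     ≡⟨ cong (λ z → z ℕ.+ z) (ℕP.^-distribˡ-+-* 2 μ ν) ⟨
      2 ^ (μ ℕ.+ ν) ℕ.+ 2 ^ (μ ℕ.+ ν)         ≡⟨ cong (2 ^ (μ ℕ.+ ν) ℕ.+_) (ℕP.+-identityʳ (2 ^ (μ ℕ.+ ν))) ⟨
      2 ^ L                                   ∎
      where open ℕP.≤-Reasoning

module TypeISumBound where

  open import Defs using (typeISum; dyadic)
  open import Data.Nat as ℕ using (ℕ; suc; _+_; _*_; _^_; _≤_; _<_; z≤n; _≤ᵇ_)
  open import Data.Nat.Properties
  open import Data.Nat.Tactic.RingSolver using (solve-∀)
  open import Data.Nat.ListAction using (sum)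
  import Data.Integer as ℤ
  import Data.Integer.Properties as ℤP
  open import Data.List using ([]; _∷_; length; map; upTo)
  import Data.List.Properties as ListP
  open import Data.List.Relation.Unary.All as All using (All; []; _∷_)
  import Data.List.Relation.Unary.All.Properties as AllP
  open import Data.List.Membership.Propositional using (_∈_)
  open import Data.List.Membership.Propositional.Properties using (∈-filter⁻; ∈-upTo⁻)
  open import Data.Bool using (T; T?)
  open import Data.Product using (_×_; _,_)
  open import Function using (_∘_)
  open import Relation.Binary.PropositionalEquality
  open import Relation.Nullary using (yes; no; contradiction)
  open GrowthBounds using (partialBound; partialBound-pow; ^-distribʳ-*)
  open DilatedSums using (dilatedSum; dilatedSum-bound)

  square-cancel-≤ : ∀ a b → a * a ≤ b * b → a ≤ b
  square-cancel-≤ a b a²≤b² with a ℕ.≤? b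
  ... | yes a≤b = a≤b
  ... | no  a≰b = contradiction (*-mono-< (≰⇒> a≰b) (≰⇒> a≰b)) (≤⇒≯ a²≤b²)

  sum-square-bound : ∀ xs D → All (λ x → x * x ≤ D) xs → sum xs * sum xs ≤ (length xs * length xs) * D
  sum-square-bound []       D []              = z≤n
  sum-square-bound (x ∷ xs) D (x²≤D ∷ xs²≤D) =
    subst₂ _≤_ (sym (expand-left x S)) (sym (expand-right k D))
      (+-mono-≤ (+-mono-≤ x²≤D (*-monoʳ-≤ 2 cross)) ih)
    where
    S = sum xs
    k = length xs
    ih : S * S ≤ (k * k) * D
    ih = sum-square-bound xs D xs²≤D
    -- the cross term: (xS)² = x²·S² ≤ D·k²D = (kD)²
    cross : x * S ≤ k * D
    cross = square-cancel-≤ (x * S) (k * D)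
      (subst₂ _≤_ (sym (regroup-left x S)) (sym (regroup-right k D)) (*-mono-≤ x²≤D ih))
      where
      regroup-left : ∀ x s → (x * s) * (x * s) ≡ (x * x) * (s * s)
      regroup-left = solve-∀
      regroup-right : ∀ k D → (k * D) * (k * D) ≡ D * ((k * k) * D)
      regroup-right = solve-∀
    expand-left : ∀ x s → (x + s) * (x + s) ≡ x * x + 2 * (x * s) + s * s
    expand-left = solve-∀
    expand-right : ∀ k D → (suc k * suc k) * D ≡ D + 2 * (k * D) + (k * k) * D
    expand-right = solve-∀

  dyadic-member : ∀ μ {m} → m ∈ dyadic μ → 2 ^ μ ≤ 2 * m × m < 2 ^ μ
  dyadic-member μ {m} m∈ with ∈-filter⁻ (T? ∘ (λ n → 2 ^ μ ≤ᵇ 2 * n)) {xs = upTo (2 ^ μ)} m∈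
  ... | m∈upTo , 2^μ≤ᵇ2m = ≤ᵇ⇒≤ (2 ^ μ) (2 * m) 2^μ≤ᵇ2m , ∈-upTo⁻ m∈upTo

  dyadic-length : ∀ μ → length (dyadic μ) ≤ 2 ^ μ
  dyadic-length μ = subst (length (dyadic μ) ≤_) (ListP.length-upTo (2 ^ μ))
                          (ListP.length-filter (T? ∘ (λ n → 2 ^ μ ≤ᵇ 2 * n)) (upTo (2 ^ μ)))

  square-abs : ∀ z D → z ℤ.* z ℤ.≤ ℤ.+ D → ℤ.∣ z ∣ * ℤ.∣ z ∣ ≤ D
  square-abs (ℤ.+ n)     D z²≤D = ℤP.drop‿+≤+ (subst (ℤ._≤ ℤ.+ D) (sym (ℤP.pos-* n n)) z²≤D)
  square-abs ℤ.-[1+ n ]  D z²≤D = ℤP.drop‿+≤+ z²≤D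

  typeISum-square-bound : ∀ μ ν (a b : ℕ → ℕ) →
    ((m : ℕ) → 2 ^ μ ≤ 2 * m → m < 2 ^ μ → (2 ^ ν < 2 * a m) × (b m ≤ 2 ^ ν)) →
    typeISum μ a b * typeISum μ a b ≤ (2 ^ μ * 2 ^ μ) * (4 * partialBound (suc (μ + ν)))
  typeISum-square-bound μ ν a b intervals =
    ≤-trans (sum-square-bound terms D terms-bounded)
            (*-monoˡ-≤ D (*-mono-≤ terms-length terms-length))
    where
    D = 4 * partialBound (suc (μ + ν))
    term : ℕ → ℕ
    term m = ℤ.∣ dilatedSum m (a m) (b m) ∣
    terms = map term (dyadic μ)
    terms-length : length terms ≤ 2 ^ μ
    terms-length = subst (_≤ 2 ^ μ) (sym (ListP.length-map term (dyadic μ))) (dyadic-length μ)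
    term-bounded : ∀ {m} → m ∈ dyadic μ → term m * term m ≤ D
    term-bounded {m} m∈ with dyadic-member μ m∈
    ... | 2^μ≤2m , m<2^μ with intervals m 2^μ≤2m m<2^μ
    ... | _ , bm≤2^ν = square-abs (dilatedSum m (a m) (b m)) D
            (dilatedSum-bound μ ν m (a m) (b m) positive (<⇒≤ m<2^μ) bm≤2^ν)
      where
      positive : 0 < m
      positive = *-cancelˡ-< 2 0 m (<-≤-trans (m^n>0 2 μ) 2^μ≤2m)
    terms-bounded : All (λ y → y * y ≤ D) terms
    terms-bounded = AllP.map⁺ (All.tabulate term-bounded)

  -- Exponent bookkeeping, stated for arbitrary bases so that no large numeral is ever unfolded.
  power-of-square : ∀ t → t ^ 20 ≡ (t * t) ^ 10
  power-of-square t = trans (^-distribˡ-+-* t 10 10) (sym (^-distribʳ-* t t 10))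

  power-of-double : ∀ a n → (a ^ n * a ^ n) ^ 10 ≡ a ^ (20 * n)
  power-of-double a n = begin
    (a ^ n * a ^ n) ^ 10   ≡⟨ cong (_^ 10) (^-distribˡ-+-* a n n) ⟨
    (a ^ (n + n)) ^ 10     ≡⟨ ^-*-assoc a (n + n) 10 ⟩
    a ^ ((n + n) * 10)     ≡⟨ cong (a ^_) (exponents n) ⟩
    a ^ (20 * n)           ∎
    where
    open ≡-Reasoning
    exponents : ∀ n → (n + n) * 10 ≡ 20 * n
    exponents = solve-∀

  power-swap : ∀ a b c → (a ^ b) ^ c ≡ (a ^ c) ^ b
  power-swap a b c = trans (^-*-assoc a b c) (trans (cong (a ^_) (*-comm b c)) (sym (^-*-assoc a c b)))

  pow-bound-arithmetic : ∀ T x u k → T * T ≤ x * x * (4 * u) → u ^ 10 ≤ 2 ^ 40 * (2 ^ 18) ^ suc k →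
                         T ^ 20 ≤ 16 ^ 20 * ((x * x) ^ 10 * (2 ^ 18) ^ k)
  pow-bound-arithmetic T x u k T²≤x²4u u-pow = begin
    T ^ 20                                                         ≡⟨ power-of-square T ⟩
    (T * T) ^ 10                                                   ≤⟨ ^-monoˡ-≤ 10 T²≤x²4u ⟩
    (x * x * (4 * u)) ^ 10                                         ≡⟨ ^-distribʳ-* (x * x) (4 * u) 10 ⟩
    (x * x) ^ 10 * (4 * u) ^ 10                                    ≡⟨ cong ((x * x) ^ 10 *_) (^-distribʳ-* 4 u 10) ⟩
    (x * x) ^ 10 * (4 ^ 10 * u ^ 10)                               ≤⟨ *-monoʳ-≤ ((x * x) ^ 10) (*-monoʳ-≤ (4 ^ 10) u-pow) ⟩
    (x * x) ^ 10 * (4 ^ 10 * (2 ^ 40 * (2 ^ 18) ^ suc k))          ≡⟨ gather ((x * x) ^ 10) (4 ^ 10) (2 ^ 40) (2 ^ 18) k ⟩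
    (4 ^ 10 * (2 ^ 40 * 2 ^ 18)) * ((x * x) ^ 10 * (2 ^ 18) ^ k)   ≤⟨ *-monoˡ-≤ ((x * x) ^ 10 * (2 ^ 18) ^ k) 2^78≤16^20 ⟩
    16 ^ 20 * ((x * x) ^ 10 * (2 ^ 18) ^ k)                        ∎
    where
    open ≤-Reasoning
    2^78≤16^20 : 4 ^ 10 * (2 ^ 40 * 2 ^ 18) ≤ 16 ^ 20
    2^78≤16^20 = ≤ᵇ⇒≤ (4 ^ 10 * (2 ^ 40 * 2 ^ 18)) (16 ^ 20) _
    -- collect the constant factors; stated for variables so that no numeral gets unfolded
    gather : ∀ X a b c k → X * (a * (b * c ^ suc k)) ≡ (a * (b * c)) * (X * c ^ k)
    gather X a b c k = regroup X a b c (c ^ k)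
      where
      regroup : ∀ X a b c Y → X * (a * (b * (c * Y))) ≡ (a * (b * c)) * (X * Y)
      regroup = solve-∀

  typeISum-pow-bound : ∀ μ ν (a b : ℕ → ℕ) →
    ((m : ℕ) → 2 ^ μ ≤ 2 * m → m < 2 ^ μ → (2 ^ ν < 2 * a m) × (b m ≤ 2 ^ ν)) →
    typeISum μ a b ^ 20 ≤ 16 ^ 20 * (2 ^ (20 * μ) * (2 ^ (μ + ν)) ^ 18)
  typeISum-pow-bound μ ν a b intervals =
    subst (typeISum μ a b ^ 20 ≤_) (cong₂ (λ p q → 16 ^ 20 * (p * q)) (power-of-double 2 μ) (power-swap 2 18 (μ + ν)))
      (pow-bound-arithmetic (typeISum μ a b) (2 ^ μ) (partialBound (suc (μ + ν))) (μ + ν)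
        (typeISum-square-bound μ ν a b intervals)
        (partialBound-pow (2 ^ 18) (2 ^ 40) (≤ᵇ⇒≤ (4 ^ 10) (2 ^ 40 * 1) _) (≤ᵇ⇒≤ (16 ^ 10) (2 ^ 40 * (2 ^ 18 * 1)) _)
                          (≤ᵇ⇒≤ (12 ^ 10) (2 ^ 18 * 2 ^ 18) _) (suc (μ + ν))))

module RationalPowers where

  open import Defs using (ℕtoℚ; _^ℚ_)
  open import Data.Nat as ℕ using (zero; suc; z≤n)
  import Data.Integer as ℤ
  import Data.Integer.Properties as ℤP
  open import Data.Rational using (mkℚ; _≤_; *≤*; _*_; 0ℚ; 1ℚ; nonNegative)
  import Data.Rational.Properties as ℚP
  open import Data.Nat.Coprimality using (1-coprimeTo) renaming (sym to coprime-sym)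
  open import Relation.Binary.PropositionalEquality

  ℕtoℚ-as-mkℚ : ∀ n → ℕtoℚ n ≡ mkℚ (ℤ.+ n) 0 (coprime-sym (1-coprimeTo n))
  ℕtoℚ-as-mkℚ n = ℚP.normalize-coprime (coprime-sym (1-coprimeTo n))

  ℕtoℚ-mono : ∀ {a b} → a ℕ.≤ b → ℕtoℚ a ≤ ℕtoℚ b
  ℕtoℚ-mono {a} {b} a≤b rewrite ℕtoℚ-as-mkℚ a | ℕtoℚ-as-mkℚ b =
    *≤* (ℤP.*-monoʳ-≤-nonNeg (ℤ.+ 1) (ℤ.+≤+ a≤b))

  ℕtoℚ-nonneg : ∀ n → 0ℚ ≤ ℕtoℚ n
  ℕtoℚ-nonneg n = ℕtoℚ-mono {0} {n} z≤n

  ℕtoℚ-* : ∀ a b → ℕtoℚ (a ℕ.* b) ≡ ℕtoℚ a * ℕtoℚ b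
  ℕtoℚ-* a b rewrite ℕtoℚ-as-mkℚ a | ℕtoℚ-as-mkℚ b = cong (λ z → z Data.Rational./ 1) (ℤP.pos-* a b)

  ℕtoℚ-^ : ∀ a k → ℕtoℚ a ^ℚ k ≡ ℕtoℚ (a ℕ.^ k)
  ℕtoℚ-^ a zero    = refl
  ℕtoℚ-^ a (suc k) = trans (cong (ℕtoℚ a *_) (ℕtoℚ-^ a k)) (sym (ℕtoℚ-* a (a ℕ.^ k)))

  ^ℚ-+ : ∀ x a b → x ^ℚ (a ℕ.+ b) ≡ x ^ℚ a * x ^ℚ b
  ^ℚ-+ x zero    b = sym (ℚP.*-identityˡ (x ^ℚ b))
  ^ℚ-+ x (suc a) b = trans (cong (x *_) (^ℚ-+ x a b)) (sym (ℚP.*-assoc x (x ^ℚ a) (x ^ℚ b)))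

  *-mono-≤-nonneg : ∀ {a b c d} → 0ℚ ≤ a → 0ℚ ≤ c → a ≤ b → c ≤ d → a * c ≤ b * d
  *-mono-≤-nonneg {a} {b} {c} {d} 0≤a 0≤c a≤b c≤d =
    ℚP.≤-trans (ℚP.*-monoʳ-≤-nonNeg c {{nonNegative 0≤c}} a≤b)
               (ℚP.*-monoˡ-≤-nonNeg b {{nonNegative (ℚP.≤-trans 0≤a a≤b)}} c≤d)

  ^ℚ-nonneg : ∀ x k → 0ℚ ≤ x → 0ℚ ≤ x ^ℚ k
  ^ℚ-nonneg x zero    0≤x = ℕtoℚ-nonneg 1
  ^ℚ-nonneg x (suc k) 0≤x = subst (_≤ x * x ^ℚ k) (ℚP.*-zeroʳ x)
    (ℚP.*-monoˡ-≤-nonNeg x {{nonNegative 0≤x}} (^ℚ-nonneg x k 0≤x))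

  ^ℚ-mono : ∀ {x y} k → 0ℚ ≤ x → x ≤ y → x ^ℚ k ≤ y ^ℚ k
  ^ℚ-mono zero    0≤x x≤y = ℚP.≤-refl
  ^ℚ-mono (suc k) 0≤x x≤y = *-mono-≤-nonneg 0≤x (^ℚ-nonneg _ k 0≤x) x≤y (^ℚ-mono k 0≤x x≤y)

  1≤^ℚ : ∀ x k → 1ℚ ≤ x → 1ℚ ≤ x ^ℚ k
  1≤^ℚ x zero    1≤x = ℚP.≤-refl
  1≤^ℚ x (suc k) 1≤x = subst (_≤ x * x ^ℚ k) (ℚP.*-identityˡ 1ℚ)
    (*-mono-≤-nonneg (ℕtoℚ-nonneg 1) (ℕtoℚ-nonneg 1) 1≤x (1≤^ℚ x k 1≤x))

module IntegralToRational where

  open import Defs using (ℕtoℚ; _^ℚ_)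
  open import Data.Nat as ℕ using (_+_; _*_; _^_)
  open import Data.Nat.Properties using (^-*-assoc; ^-monoˡ-≤; module ≤-Reasoning)
  open import Data.Nat.Tactic.RingSolver using (solve-∀)
  open import Data.Rational as Q using (ℚ; _≤_; 0ℚ; 1ℚ; nonNegative)
  import Data.Rational.Properties as ℚP
  open import Relation.Binary.PropositionalEquality
  open GrowthBounds using (^-distribʳ-*)
  open RationalPowers

  pow-bound-power : ∀ T c Y Z q → T ^ 20 ℕ.≤ c ^ 20 * (Y * Z ^ 18) →
                    T ^ (20 * q) ℕ.≤ c ^ (20 * q) * (Y ^ q * Z ^ (18 * q))
  pow-bound-power T c Y Z q T²⁰≤ = begin
    T ^ (20 * q)                             ≡⟨ ^-*-assoc T 20 q ⟨
    (T ^ 20) ^ q                             ≤⟨ ^-monoˡ-≤ q T²⁰≤ ⟩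
    (c ^ 20 * (Y * Z ^ 18)) ^ q              ≡⟨ ^-distribʳ-* (c ^ 20) (Y * Z ^ 18) q ⟩
    (c ^ 20) ^ q * (Y * Z ^ 18) ^ q          ≡⟨ cong₂ _*_ (^-*-assoc c 20 q) (^-distribʳ-* Y (Z ^ 18) q) ⟩
    c ^ (20 * q) * (Y ^ q * (Z ^ 18) ^ q)    ≡⟨ cong (λ z → c ^ (20 * q) * (Y ^ q * z)) (^-*-assoc Z 18 q) ⟩
    c ^ (20 * q) * (Y ^ q * Z ^ (18 * q))    ∎
    where open ≤-Reasoning

  rational-bound : ∀ T c Y Z p q X → T ^ 20 ℕ.≤ c ^ 20 * (Y * Z ^ 18) →
                   ℕtoℚ 2 ≤ X → ℕtoℚ Y ≤ X → ℕtoℚ Z ≤ X →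
                   ℕtoℚ T ^ℚ (20 * q) ≤ (ℕtoℚ c ^ℚ (20 * q)) Q.* (X ^ℚ (19 * q + 20 * p))
  rational-bound T c Y Z p q X T²⁰≤ 2≤X Y≤X Z≤X = begin
    ℕtoℚ T ^ℚ (20 * q)                                 ≡⟨ ℕtoℚ-^ T (20 * q) ⟩
    ℕtoℚ (T ^ (20 * q))                                ≤⟨ ℕtoℚ-mono (pow-bound-power T c Y Z q T²⁰≤) ⟩
    ℕtoℚ (c ^ (20 * q) * (Y ^ q * Z ^ (18 * q)))        ≡⟨ as-rational-powers ⟩
    C* (ℕtoℚ Y ^ℚ q Q.* ℕtoℚ Z ^ℚ (18 * q))             ≤⟨ C*-mono (*-mono-≤-nonneg (^ℚ-nonneg _ q (ℕtoℚ-nonneg Y)) (^ℚ-nonneg _ (18 * q) (ℕtoℚ-nonneg Z))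
                                                                     (^ℚ-mono q (ℕtoℚ-nonneg Y) Y≤X) (^ℚ-mono (18 * q) (ℕtoℚ-nonneg Z) Z≤X)) ⟩
    C* (X ^ℚ q Q.* X ^ℚ (18 * q))                       ≡⟨ cong C* (trans (sym (^ℚ-+ X q (18 * q))) (cong (X ^ℚ_) (nineteen q))) ⟩
    C* (X ^ℚ (19 * q))                                 ≡⟨ cong C* (sym (ℚP.*-identityʳ (X ^ℚ (19 * q)))) ⟩
    C* (X ^ℚ (19 * q) Q.* 1ℚ)                           ≤⟨ C*-mono (*-mono-≤-nonneg (^ℚ-nonneg X (19 * q) 0≤X) (ℕtoℚ-nonneg 1) ℚP.≤-refl (1≤^ℚ X (20 * p) 1≤X)) ⟩
    C* (X ^ℚ (19 * q) Q.* X ^ℚ (20 * p))                ≡⟨ cong C* (sym (^ℚ-+ X (19 * q) (20 * p))) ⟩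
    C* (X ^ℚ (19 * q + 20 * p))                        ∎
    where
    open ℚP.≤-Reasoning
    C* : ℚ → ℚ
    C* z = ℕtoℚ c ^ℚ (20 * q) Q.* z
    C*-mono : ∀ {z w} → z ≤ w → C* z ≤ C* w
    C*-mono = ℚP.*-monoˡ-≤-nonNeg (ℕtoℚ c ^ℚ (20 * q)) {{nonNegative (^ℚ-nonneg (ℕtoℚ c) (20 * q) (ℕtoℚ-nonneg c))}}
    0≤X : 0ℚ ≤ X
    0≤X = ℚP.≤-trans (ℕtoℚ-nonneg 2) 2≤X
    1≤X : 1ℚ ≤ X
    1≤X = ℚP.≤-trans (ℕtoℚ-mono {1} {2} (ℕ.s≤s ℕ.z≤n)) 2≤X
    nineteen : ∀ q → q + 18 * q ≡ 19 * q
    nineteen = solve-∀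
    as-rational-powers : ℕtoℚ (c ^ (20 * q) * (Y ^ q * Z ^ (18 * q))) ≡ C* (ℕtoℚ Y ^ℚ q Q.* ℕtoℚ Z ^ℚ (18 * q))
    as-rational-powers = begin-equality
      ℕtoℚ (c ^ (20 * q) * (Y ^ q * Z ^ (18 * q)))             ≡⟨ ℕtoℚ-* (c ^ (20 * q)) (Y ^ q * Z ^ (18 * q)) ⟩
      ℕtoℚ (c ^ (20 * q)) Q.* ℕtoℚ (Y ^ q * Z ^ (18 * q))      ≡⟨ cong (ℕtoℚ (c ^ (20 * q)) Q.*_) (ℕtoℚ-* (Y ^ q) (Z ^ (18 * q))) ⟩
      ℕtoℚ (c ^ (20 * q)) Q.* (ℕtoℚ (Y ^ q) Q.* ℕtoℚ (Z ^ (18 * q)))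
                 ≡⟨ sym (cong₂ (λ u v → u Q.* v) (ℕtoℚ-^ c (20 * q)) (cong₂ Q._*_ (ℕtoℚ-^ Y q) (ℕtoℚ-^ Z (18 * q)))) ⟩
      C* (ℕtoℚ Y ^ℚ q Q.* ℕtoℚ Z ^ℚ (18 * q))                  ∎

open import Defs
open import Data.Nat using (ℕ; _+_; _*_; _^_; _<_)
open import Data.Product using (Σ; _×_; _,_)
open import Data.Rational using (ℚ; _≤_)
open TypeISumBound using (typeISum-pow-bound)
open RationalPowers using (ℕtoℚ-nonneg)
open IntegralToRational using (rational-bound)

mainTheorem5 : (p q : ℕ) → 0 < p → 0 < q →
    Σ ℚ (λ C → (ℕtoℚ 0 ≤ C) ×
      ((X : ℚ) (μ ν : ℕ) (a b : ℕ → ℕ) →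
        ℕtoℚ 2 ≤ X →
        ℕtoℚ (2 ^ (20 * μ)) ≤ X →
        ℕtoℚ (2 ^ (μ + ν)) ≤ X →
        ((m : ℕ) → 2 ^ μ Data.Nat.≤ 2 * m → m < 2 ^ μ →
          (2 ^ ν < 2 * a m) × (b m Data.Nat.≤ 2 ^ ν)) →
        ℕtoℚ (typeISum μ a b) ^ℚ (20 * q)
          ≤ (C ^ℚ (20 * q)) Data.Rational.* (X ^ℚ (19 * q + 20 * p))))
mainTheorem5 p q _ _ = ℕtoℚ 16 , ℕtoℚ-nonneg 16 ,
  λ X μ ν a b 2≤X 2^20μ≤X 2^[μ+ν]≤X intervals →
    rational-bound (typeISum μ a b) 16 (2 ^ (20 * μ)) (2 ^ (μ + ν)) p q X
                   (typeISum-pow-bound μ ν a b intervals) 2≤X 2^20μ≤X 2^[μ+ν]≤X
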